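{- In intensional Martin-Löf type theory (no truncation, no function extensionality assumed), for every type $X:\mathcal U$ we have a logical equivalence $$\mathrm{Pop}(X)\;\Leftrightarrow\;\prod_{P:\mathcal U}\mathrm{isProp}(P)\to(P\to X)\to(X\to P)\to P,$$ where $\mathrm{Pop}(X):\equiv\prod_{f:X\to X}\Big(\big(\prod_{x,y:X}f(x)=f(y)\big)\to\sum_{x:X}x=f(x)\Big)$.
   Context: Intensional Martin-Löf type theory with a universe $\mathcal U$, $\Sigma$, $\Pi$, $+$ and identity types (J only; no UIP/K). $\mathrm{isProp}(A):\equiv\prod_{a,b:A}a=b$. $A\Leftrightarrow B$ means there are functions $A\to B$ and $B\to A$. -}

{-# OPTIONS --without-K #-}
module Defs where

open import Data.Product using (Σ; _×_)
open import Relation.Binary.PropositionalEquality using (_≡_)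

isProp : Set → Set
isProp A = (a b : A) → a ≡ b

wconst : {X : Set} → (X → X) → Set
wconst {X} f = (x y : X) → f x ≡ f y

Pop : Set → Set
Pop X = (f : X → X) → wconst f → Σ X (λ x → x ≡ f x)

PropRetractSplit : Set → Set₁
PropRetractSplit X = (P : Set) → isProp P → (P → X) → (X → P) → P

_⇔_ : ∀ {a b} → Set a → Set b → Set _
A ⇔ B = (A → B) × (B → A)

{-# OPTIONS --without-K #-}
module Submission where

open import Defs
open import Data.Product using (Σ; _,_; proj₁)
open import Function using (_∘_)
open import Relation.Binary.PropositionalEquality

-- The fixed points of a weakly constant endofunction f form a proposition
-- retract of X, so splitting that retract yields a fixed point of f.
-- Conversely, for a proposition retract (s, r) of X the composite s ∘ r is
-- weakly constant, and r sends any of its fixed points into the proposition.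

-- Without K this is what pins down the path-over in Fix-isProp.
cong-wconst : {X Y : Set} (f : X → Y) (c : (x y : X) → f x ≡ f y) {x y : X}
              (e : x ≡ y) → cong f e ≡ trans (sym (c x x)) (c x y)
cong-wconst f c {x} refl = sym (trans-symˡ (c x x))

Fix : {X : Set} → (X → X) → Set
Fix {X} f = Σ X (λ x → x ≡ f x)

Fix-≡ : {X : Set} (f : X → X) {x y : X} (p : x ≡ f x) (q : y ≡ f y) (e : x ≡ y) →
        trans (sym e) (trans p (cong f e)) ≡ q → (x , p) ≡ (y , q)
Fix-≡ f p q refl h = cong (_ ,_) (trans (sym (trans-reflʳ p)) h)

Fix-isProp : {X : Set} (f : X → X) → wconst f → isProp (Fix f)
Fix-isProp f c (x , p) (y , q) = Fix-≡ f p q e path-over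
  where
  r : f x ≡ f y
  r = trans (sym (c x x)) (c x y)

  e : x ≡ y
  e = trans p (trans r (sym q))

  cancel : {a b d : _} (p′ : a ≡ b) (r′ : b ≡ d) (q′ : _ ≡ d) →
           trans (sym (trans p′ (trans r′ (sym q′)))) (trans p′ r′) ≡ q′
  cancel refl refl refl = refl

  path-over : trans (sym e) (trans p (cong f e)) ≡ q
  path-over = begin
    trans (sym e) (trans p (cong f e)) ≡⟨ cong (trans (sym e) ∘ trans p) (cong-wconst f c e) ⟩
    trans (sym e) (trans p r)          ≡⟨ cancel p r q ⟩
    q                                  ∎
    where open ≡-Reasoning

wconst-section∘retraction : {X P : Set} → isProp P → (s : P → X) (r : X → P) →
                            wconst (s ∘ r)
wconst-section∘retraction P-prop s r x y = cong s (P-prop (r x) (r y))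

Pop⇒PropRetractSplit : (X : Set) → Pop X → PropRetractSplit X
Pop⇒PropRetractSplit X pop P P-prop s r =
  r (proj₁ (pop (s ∘ r) (wconst-section∘retraction P-prop s r)))

PropRetractSplit⇒Pop : (X : Set) → PropRetractSplit X → Pop X
-- Every f x is a fixed point, since constancy gives f x ≡ f (f x).
PropRetractSplit⇒Pop X split f c =
  split (Fix f) (Fix-isProp f c) proj₁ (λ x → f x , c x (f x))

theorem6p4 : (X : Set) → Pop X ⇔ PropRetractSplit X
theorem6p4 X = Pop⇒PropRetractSplit X , PropRetractSplit⇒Pop X
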